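{- In a soft sequence heap with rank threshold $r_0=\lceil\lg\frac1\epsilon\rceil$, a sequence of rank $r$ contains at most $s_r=2^r$ items for $r\le r_0$, and at most $s_r=(2^{r_0}+1)\cdot 2^{\lceil (r-r_0)/2\rceil}$ items for $r>r_0$.
   Context: Soft sequence heap with error parameter $0<\epsilon<1$ and rank threshold $r_0=\lceil\lg\frac1\epsilon\rceil$. The heap is a list of non-empty sequences $L_1,\dots,L_\ell$, each sorted increasingly by real key and having a non-negative integer rank, with strictly increasing ranks. Each item $e$ in a sequence carries a corruption-set $C(e)$ and a witness-set $W(e)$. Operation reduce$(L)$ on $L=e_1,\dots,e_m$: for every $1\le i<m/2$, the item $e_{2i}$ is removed from $L$, the items $\{e_{2i}\}\cup C(e_{2i})$ are appended to $C(e_{2i+1})$ and $\{e_{2i}\}\cup W(e_{2i})$ are appended to $W(e_{2i-1})$. Insert$(e)$ creates a rank-0 sequence $(e)$ at the front of the list; while the first two sequences have equal rank $r$, they are merged (by key) into one sequence of rank $r+1$, and whenever a created sequence has rank $r'>r_0$ with $r'-r_0$ even, reduce is applied to it. Meld merges the lists by rank and repeatedly merges two equal-rank sequences into one of the next rank, applying reduce under the same rule. Extract-min either removes an item from the corruption-set of the minimum head item, or removes the minimum head item $e$ from its sequence (the items of $W(e)$ then lose their witness). Items are otherwise never added to sequences.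
   Formalization: The keys of the items and the error parameter ε are rational rather than real. -}

module Defs where

open import Data.Nat using (ℕ; zero; suc; _∸_; _^_; ⌈_/2⌉; _<ᵇ_; _≤ᵇ_)
  renaming (_+_ to _+ℕ_; _*_ to _*ℕ_; _≤_ to _≤ℕ_; _<_ to _<ℕ_)
open import Data.Nat.Properties using (<-cmp)
open import Data.Integer using (+_)
open import Data.Rational using (ℚ; _/_; _*_; _≤_; _<_; 0ℚ; 1ℚ)
import Data.Rational.Properties as ℚP
open import Data.List using (List; []; _∷_; _++_; length; merge)
open import Data.List.Relation.Unary.All using (All)
open import Data.List.Membership.Propositional using (_∈_)
open import Data.Bool using (Bool; true; false; if_then_else_; _∧_)
open import Data.Product using (_×_)
open import Relation.Binary using (tri<; tri≈; tri>)
open import Relation.Nullary using (Dec)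
open import Relation.Binary.PropositionalEquality using (_≡_)

-- Items: a (real, here rational) key, a corruption-set C(e) and a
-- witness-set W(e) (sets represented as lists of items).

data Item : Set where
  item : (key : ℚ) → (C : List Item) → (W : List Item) → Item

key : Item → ℚ
key (item k _ _) = k

Cset : Item → List Item
Cset (item _ c _) = c

Wset : Item → List Item
Wset (item _ _ w) = w

setC : List Item → Item → Item
setC c (item k _ w) = item k c w

_≤ᵢ_ : Item → Item → Set
x ≤ᵢ y = key x ≤ key y

_≤ᵢ?_ : (x y : Item) → Dec (x ≤ᵢ y)
x ≤ᵢ? y = key x ℚP.≤? key y

record Seq : Set where
  constructor mkSeq
  field
    rank  : ℕ
    items : List Item
open Seq public

Heap : Set
Heap = List Seq

-- reduce(L) on L = e₁,…,e_m: for every 1 ≤ i < m/2 (i.e. whenever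
-- e_{2i+1} exists) remove e_{2i}, append {e_{2i}} ∪ C(e_{2i}) to
-- C(e_{2i+1}) and {e_{2i}} ∪ W(e_{2i}) to W(e_{2i-1}).

addC : Item → Item → Item
addC b (item k c w) = item k (c ++ (b ∷ Cset b)) w

addW : Item → Item → Item
addW b (item k c w) = item k c (w ++ (b ∷ Wset b))

-- reduceFrom a xs : reduce applied to the list a ∷ xs, where a is at an
-- odd position e_{2i-1}.
reduceFrom : Item → List Item → List Item
reduceFrom a (b ∷ c ∷ rest) = addW b a ∷ reduceFrom (addC b c) rest
reduceFrom a xs             = a ∷ xs

reduce : List Item → List Item
reduce []       = []
reduce (a ∷ xs) = reduceFrom a xs

even? : ℕ → Bool
even? zero          = true
even? (suc zero)    = false
even? (suc (suc n)) = even? n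

reduceRule : ℕ → ℕ → Bool
reduceRule r₀ r' = (r₀ <ᵇ r') ∧ even? (r' ∸ r₀)

link : ℕ → Seq → Seq → Seq
link r₀ s t =
  let r'  = suc (rank s)
      m   = merge _≤ᵢ?_ (items s) (items t)
  in mkSeq r' (if reduceRule r₀ r' then reduce m else m)

carry : ℕ → Seq → Heap → Heap
carry r₀ s []      = s ∷ []
carry r₀ s (t ∷ h) with <-cmp (rank s) (rank t)
... | tri≈ _ _ _ = carry r₀ (link r₀ s t) h
... | tri< _ _ _ = s ∷ t ∷ h
... | tri> _ _ _ = s ∷ t ∷ h

insert : ℕ → ℚ → Heap → Heap
insert r₀ k h = carry r₀ (mkSeq 0 (item k [] [] ∷ [])) h

meld : ℕ → Heap → Heap → Heap
meld r₀ []       h₂ = h₂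
meld r₀ (s ∷ h₁) h₂ = go h₂
  where
  go : Heap → Heap
  go []       = s ∷ h₁
  go (t ∷ h₂') with <-cmp (rank s) (rank t)
  ... | tri< _ _ _ = s ∷ meld r₀ h₁ (t ∷ h₂')
  ... | tri> _ _ _ = t ∷ go h₂'
  ... | tri≈ _ _ _ = carry r₀ (link r₀ s t) (meld r₀ h₁ h₂')

heads : Heap → List Item
heads []                      = []
heads (mkSeq _ [] ∷ h)        = heads h
heads (mkSeq _ (x ∷ _) ∷ h)   = x ∷ heads h

dropEmpty : Seq → Heap
dropEmpty (mkSeq r []) = []
dropEmpty (mkSeq r (x ∷ xs)) = mkSeq r (x ∷ xs) ∷ []

data ExtractMin : Heap → Heap → Set where
  fromCorruption : ∀ pre post r x xs ys y zs →
    All (λ z → x ≤ᵢ z) (heads (pre ++ mkSeq r (x ∷ xs) ∷ post)) →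
    Cset x ≡ ys ++ y ∷ zs →
    ExtractMin (pre ++ mkSeq r (x ∷ xs) ∷ post)
               (pre ++ mkSeq r (setC (ys ++ zs) x ∷ xs) ∷ post)
  removeHead : ∀ pre post r x xs →
    All (λ z → x ≤ᵢ z) (heads (pre ++ mkSeq r (x ∷ xs) ∷ post)) →
    ExtractMin (pre ++ mkSeq r (x ∷ xs) ∷ post)
               (pre ++ dropEmpty (mkSeq r xs) ++ post)

data Reachable (r₀ : ℕ) : Heap → Set where
  empty   : Reachable r₀ []
  ins     : ∀ {h} (k : ℚ) → Reachable r₀ h → Reachable r₀ (insert r₀ k h)
  mld     : ∀ {h₁ h₂} → Reachable r₀ h₁ → Reachable r₀ h₂ →
            Reachable r₀ (meld r₀ h₁ h₂)
  extract : ∀ {h h'} → Reachable r₀ h → ExtractMin h h' → Reachable r₀ h'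

-- r₀ = ⌈lg (1/ε)⌉ for 0 < ε < 1, i.e. 2^(r₀-1) < 1/ε ≤ 2^r₀, written
-- without division: 2^(r₀-1)·ε < 1 ≤ 2^r₀·ε.

ℕtoℚ : ℕ → ℚ
ℕtoℚ n = + n / 1

IsCeilLgInv : ℚ → ℕ → Set
IsCeilLgInv ε r₀ = (1ℚ ≤ ℕtoℚ (2 ^ r₀) * ε) × (ℕtoℚ (2 ^ (r₀ ∸ 1)) * ε < 1ℚ)

sizeBound : ℕ → ℕ → ℕ
sizeBound r₀ r with r ≤ᵇ r₀
... | true  = 2 ^ r
... | false = (2 ^ r₀ +ℕ 1) *ℕ 2 ^ ⌈ (r ∸ r₀) /2⌉

{-# OPTIONS --safe #-}
-- The bound is proved with a slack σ(r): every sequence satisfies |L| + σ(r) ≤ s_r,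
-- where σ(r) = 0 for r ≤ r₀, σ(r) = 1 if r − r₀ > 0 is even (the ranks at which
-- reduce is applied) and σ(r) = 2 if r − r₀ is odd. Linking two sequences of rank r
-- merges m ≤ 2 s_r − 2 σ(r) items. If r + 1 − r₀ is odd then s_{r+1} = 2 s_r, or
-- s_{r₀+1} = 2 s_{r₀} + 2 at the first step above r₀, which leaves slack 2. If it is
-- even and positive then s_{r+1} = s_r, and reduce leaves ℓ items with 2 ℓ ≤ m + 2,
-- so m ≤ 2 s_r − 4 gives ℓ + 1 ≤ s_r.
module Submission where

open import Defs
open import Data.Nat using (ℕ; _≤_)
open import Data.Rational using (ℚ; 0ℚ; 1ℚ; _<_)
open import Data.List using (List; length)
open import Data.List.Membership.Propositional using (_∈_)

open import Data.Bool using (true; false; if_then_else_)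
open import Data.Nat
  using (zero; suc; _+_; _*_; _∸_; _^_; ⌈_/2⌉; _≤ᵇ_; _<ᵇ_; z≤n; s≤s; z<s)
  renaming (_<_ to _<ℕ_)
open import Data.Nat.Properties
open import Data.Nat.Tactic.RingSolver using (solve-∀)
open import Data.List using ([]; _∷_; merge)
open import Data.List.Properties using (length-++)
open import Data.List.Relation.Unary.All as All using (All; []; _∷_)
open import Data.List.Relation.Unary.All.Properties using (++⁻; ++⁺)
open import Data.List.Relation.Binary.Permutation.Propositional.Properties
  using (merge-↭; ↭-length)
open import Data.Product using (_,_)
open import Function using (id)
open import Data.Sum using (inj₁; inj₂)
open import Relation.Binary using (tri<; tri≈; tri>)
open import Relation.Binary.PropositionalEquality
open import Relation.Nullary using (¬_; contradiction)

≤ᵇ-true : ∀ {m n} → m ≤ n → (m ≤ᵇ n) ≡ true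
≤ᵇ-true {m} {n} m≤n with m ≤ᵇ n | ≤⇒≤ᵇ m≤n
... | true | _ = refl

≤ᵇ-false : ∀ {m n} → ¬ m ≤ n → (m ≤ᵇ n) ≡ false
≤ᵇ-false {m} {n} m≰n with m ≤ᵇ n | ≤ᵇ⇒≤ m n
... | false | _   = refl
... | true  | m≤n = contradiction (m≤n _) m≰n

<ᵇ-true : ∀ {m n} → m <ℕ n → (m <ᵇ n) ≡ true
<ᵇ-true = ≤ᵇ-true

<ᵇ-false : ∀ {m n} → ¬ m <ℕ n → (m <ᵇ n) ≡ false
<ᵇ-false = ≤ᵇ-false

data Parity : ℕ → Set where
  even : ∀ i → Parity (i + i)
  odd  : ∀ i → Parity (suc (i + i))

parity : ∀ n → Parity n
parity zero = even zero
parity (suc n) with parity n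
... | even i = odd i
... | odd i  = subst Parity (cong suc (+-suc i i)) (even (suc i))

even?-double : ∀ i → even? (i + i) ≡ true
even?-double zero    = refl
even?-double (suc i) rewrite +-suc i i = even?-double i

even?-suc-double : ∀ i → even? (suc (i + i)) ≡ false
even?-suc-double zero    = refl
even?-suc-double (suc i) rewrite +-suc i i = even?-suc-double i

⌈suc-double/2⌉ : ∀ i → ⌈ suc (i + i) /2⌉ ≡ suc i
⌈suc-double/2⌉ i = cong suc (sym (n≡⌊n+n/2⌋ i))

-- above d is the rank r₀ + (d + 1), written so that the rank of a link,
-- suc (suc d + r₀), is again of the form suc d′ + r₀ definitionally.
data RankClass (r₀ : ℕ) : ℕ → Set where
  below : ∀ {r} → r ≤ r₀ → RankClass r₀ r
  above : ∀ d → RankClass r₀ (suc d + r₀)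

rankClass : ∀ r₀ r → RankClass r₀ r
rankClass r₀       zero    = below z≤n
rankClass zero     (suc d) = subst (RankClass zero) (cong suc (+-identityʳ d)) (above d)
rankClass (suc r₀) (suc r) with rankClass r₀ r
... | below r≤r₀ = below (s≤s r≤r₀)
... | above d    = subst (RankClass (suc r₀)) (+-suc (suc d) r₀) (above d)

reduceRule-below : ∀ {r₀ r} → r ≤ r₀ → reduceRule r₀ r ≡ false
reduceRule-below r≤r₀ rewrite <ᵇ-false (≤⇒≯ r≤r₀) = refl

reduceRule-above : ∀ r₀ d → reduceRule r₀ (suc d + r₀) ≡ even? (suc d)
reduceRule-above r₀ d rewrite <ᵇ-true (m<n+m r₀ {suc d} z<s) | m+n∸n≡m (suc d) r₀ = refl

slack : ℕ → ℕ → ℕ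
slack r₀ r = if r ≤ᵇ r₀ then 0 else if even? (r ∸ r₀) then 1 else 2

Fits : ℕ → Seq → Set
Fits r₀ s = length (items s) + slack r₀ (rank s) ≤ sizeBound r₀ (rank s)

fits-below : ∀ {r₀ r} xs → r ≤ r₀ → Fits r₀ (mkSeq r xs) ≡ (length xs + 0 ≤ 2 ^ r)
fits-below xs r≤r₀ rewrite ≤ᵇ-true r≤r₀ = refl

fits-above : ∀ r₀ d xs → Fits r₀ (mkSeq (suc d + r₀) xs) ≡
             (length xs + (if even? (suc d) then 1 else 2) ≤ (2 ^ r₀ + 1) * 2 ^ ⌈ suc d /2⌉)
fits-above r₀ d xs
  rewrite ≤ᵇ-false (<⇒≱ (m<n+m r₀ {suc d} z<s)) | m+n∸n≡m (suc d) r₀ = refl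

fits-oddOffset : ∀ r₀ i xs → Fits r₀ (mkSeq (suc (i + i) + r₀) xs) ≡
                 (length xs + 2 ≤ (2 ^ r₀ + 1) * 2 ^ suc i)
fits-oddOffset r₀ i xs = trans (fits-above r₀ (i + i) xs)
  (cong₂ (λ b e → length xs + (if b then 1 else 2) ≤ (2 ^ r₀ + 1) * 2 ^ e)
         (even?-suc-double i) (⌈suc-double/2⌉ i))

fits-evenOffset : ∀ r₀ i xs → Fits r₀ (mkSeq (suc (suc (i + i)) + r₀) xs) ≡
                  (length xs + 1 ≤ (2 ^ r₀ + 1) * 2 ^ suc i)
fits-evenOffset r₀ i xs = trans (fits-above r₀ (suc (i + i)) xs)
  (cong₂ (λ b e → length xs + (if b then 1 else 2) ≤ (2 ^ r₀ + 1) * 2 ^ e)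
         (even?-double i) (cong suc (sym (n≡⌈n+n/2⌉ i))))

length-merge : ∀ xs ys → length (merge _≤ᵢ?_ xs ys) ≡ length xs + length ys
length-merge xs ys = trans (↭-length (merge-↭ _≤ᵢ?_ xs ys)) (length-++ xs)

length-reduceFrom : ∀ x xs → 2 * length (reduceFrom x xs) ≤ length (x ∷ xs) + 2
length-reduceFrom x []            = s≤s (s≤s z≤n)
length-reduceFrom x (y ∷ [])      = s≤s (s≤s (s≤s (s≤s z≤n)))
length-reduceFrom x (y ∷ z ∷ xs)
  rewrite *-suc 2 (length (reduceFrom (addC y z) xs)) =
  s≤s (s≤s (length-reduceFrom (addC y z) xs))

length-reduce : ∀ xs → 2 * length (reduce xs) ≤ length xs + 2
length-reduce []       = z≤n
length-reduce (x ∷ xs) = length-reduceFrom x xs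

merge-≤ : ∀ {k n} xs ys → length xs + k ≤ n → length ys + k ≤ n →
          length (merge _≤ᵢ?_ xs ys) + (k + k) ≤ 2 * n
merge-≤ {k} {n} xs ys xs≤ ys≤ = begin
  length (merge _≤ᵢ?_ xs ys) + (k + k) ≡⟨ cong (_+ (k + k)) (length-merge xs ys) ⟩
  length xs + length ys + (k + k)      ≡⟨ +-shuffle (length xs) (length ys) k ⟩
  (length xs + k) + (length ys + k)    ≤⟨ +-mono-≤ xs≤ ys≤ ⟩
  n + n                                ≡⟨ sym (+-double n) ⟩
  2 * n                                ∎
  where
  open ≤-Reasoning
  +-shuffle : ∀ a b k → a + b + (k + k) ≡ (a + k) + (b + k)
  +-shuffle = solve-∀
  +-double : ∀ n → 2 * n ≡ n + n
  +-double = solve-∀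

reduce-≤ : ∀ {n} xs → length xs + 4 ≤ 2 * n → length (reduce xs) + 1 ≤ n
reduce-≤ {n} xs xs≤ = *-cancelˡ-≤ 2 (begin
  2 * (length (reduce xs) + 1) ≡⟨ *-distribˡ-+ 2 (length (reduce xs)) 1 ⟩
  2 * length (reduce xs) + 2   ≤⟨ +-monoˡ-≤ 2 (length-reduce xs) ⟩
  length xs + 2 + 2            ≡⟨ +-assoc (length xs) 2 2 ⟩
  length xs + 4                ≤⟨ xs≤ ⟩
  2 * n                        ∎)
  where open ≤-Reasoning

link-unreduced : ∀ {r₀ r} xs ys → reduceRule r₀ (suc r) ≡ false →
                 link r₀ (mkSeq r xs) (mkSeq r ys) ≡ mkSeq (suc r) (merge _≤ᵢ?_ xs ys)
link-unreduced xs ys e rewrite e = refl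

link-reduced : ∀ {r₀ r} xs ys → reduceRule r₀ (suc r) ≡ true →
               link r₀ (mkSeq r xs) (mkSeq r ys) ≡ mkSeq (suc r) (reduce (merge _≤ᵢ?_ xs ys))
link-reduced xs ys e rewrite e = refl

LinkFits : ℕ → ℕ → Set
LinkFits r₀ r = ∀ xs ys → Fits r₀ (mkSeq r xs) → Fits r₀ (mkSeq r ys) →
                Fits r₀ (link r₀ (mkSeq r xs) (mkSeq r ys))

link-fits-below : ∀ {r₀ r} → suc r ≤ r₀ → LinkFits r₀ r
link-fits-below {r₀} {r} r<r₀ xs ys xs-fits ys-fits =
  subst (Fits r₀) (sym (link-unreduced {r₀} xs ys (reduceRule-below r<r₀)))
    (subst id (sym (fits-below (merge _≤ᵢ?_ xs ys) r<r₀))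
      (merge-≤ xs ys (subst id (fits-below xs r≤r₀) xs-fits)
                     (subst id (fits-below ys r≤r₀) ys-fits)))
  where r≤r₀ = <⇒≤ r<r₀

link-fits-threshold : ∀ {r₀} → LinkFits r₀ r₀
link-fits-threshold {r₀} xs ys xs-fits ys-fits =
  subst (Fits r₀) (sym (link-unreduced {r₀} xs ys (reduceRule-above r₀ 0)))
    (subst id (sym (fits-oddOffset r₀ 0 merged)) (begin
      length merged + 2     ≤⟨ +-monoˡ-≤ 2 merged≤ ⟩
      2 * 2 ^ r₀ + 2        ≡⟨ double-+2 (2 ^ r₀) ⟩
      (2 ^ r₀ + 1) * 2 ^ 1  ∎))
  where
  open ≤-Reasoning
  merged = merge _≤ᵢ?_ xs ys
  merged≤ : length merged ≤ 2 * 2 ^ r₀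
  merged≤ = subst (_≤ 2 * 2 ^ r₀) (+-identityʳ (length merged))
    (merge-≤ xs ys (subst id (fits-below xs (≤-refl {r₀})) xs-fits)
                   (subst id (fits-below ys (≤-refl {r₀})) ys-fits))
  double-+2 : ∀ n → 2 * n + 2 ≡ (n + 1) * 2 ^ 1
  double-+2 = solve-∀

link-fits-oddOffset : ∀ {r₀} i → LinkFits r₀ (suc (i + i) + r₀)
link-fits-oddOffset {r₀} i xs ys xs-fits ys-fits =
  subst (Fits r₀) (sym (link-reduced {r₀} xs ys
                          (trans (reduceRule-above r₀ (suc (i + i))) (even?-double i))))
    (subst id (sym (fits-evenOffset r₀ i (reduce (merge _≤ᵢ?_ xs ys))))
      (reduce-≤ (merge _≤ᵢ?_ xs ys)
        (merge-≤ xs ys (subst id (fits-oddOffset r₀ i xs) xs-fits)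
                       (subst id (fits-oddOffset r₀ i ys) ys-fits))))

link-fits-evenOffset : ∀ {r₀} i → LinkFits r₀ (suc (suc (i + i)) + r₀)
link-fits-evenOffset {r₀} i xs ys xs-fits ys-fits =
  subst (Fits r₀) (sym (link-unreduced {r₀} xs ys
                          (trans (reduceRule-above r₀ (suc (suc (i + i)))) (even?-suc-double i))))
    (subst (λ d → Fits r₀ (mkSeq (suc d + r₀) merged)) (cong suc (+-suc i i))
      (subst id (sym (fits-oddOffset r₀ (suc i) merged))
        (subst (length merged + 2 ≤_) (double-swap (2 ^ r₀ + 1) (2 ^ suc i))
          (merge-≤ xs ys (subst id (fits-evenOffset r₀ i xs) xs-fits)
                         (subst id (fits-evenOffset r₀ i ys) ys-fits)))))
  where
  merged = merge _≤ᵢ?_ xs ys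
  double-swap : ∀ w p → 2 * (w * p) ≡ w * (2 * p)
  double-swap = solve-∀

link-fits : ∀ {r₀} s t → rank s ≡ rank t → Fits r₀ s → Fits r₀ t → Fits r₀ (link r₀ s t)
link-fits {r₀} (mkSeq r xs) (mkSeq .r ys) refl with rankClass r₀ r
... | below r≤r₀ with m≤n⇒m<n∨m≡n r≤r₀
...   | inj₁ r<r₀ = link-fits-below {r₀} r<r₀ xs ys
...   | inj₂ refl = link-fits-threshold {r₀} xs ys
link-fits {r₀} (mkSeq _ xs) (mkSeq _ ys) refl | above d with parity d
... | even i = link-fits-oddOffset {r₀} i xs ys
... | odd i  = link-fits-evenOffset {r₀} i xs ys

carry-fits : ∀ {r₀} s h → Fits r₀ s → All (Fits r₀) h → All (Fits r₀) (carry r₀ s h)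
carry-fits s []      s-fits []               = s-fits ∷ []
carry-fits {r₀} s (t ∷ h) s-fits (t-fits ∷ h-fits) with <-cmp (rank s) (rank t)
... | tri≈ _ s≡t _ = carry-fits (link r₀ s t) h (link-fits s t s≡t s-fits t-fits) h-fits
... | tri< _ _ _   = s-fits ∷ t-fits ∷ h-fits
... | tri> _ _ _   = s-fits ∷ t-fits ∷ h-fits

meld-fits : ∀ {r₀} h₁ h₂ → All (Fits r₀) h₁ → All (Fits r₀) h₂ → All (Fits r₀) (meld r₀ h₁ h₂)
meld-fits []       h₂ _                 h₂-fits = h₂-fits
meld-fits {r₀} (s ∷ h₁) h₂ (s-fits ∷ h₁-fits) h₂-fits = go h₂ h₂-fits
  where
  go : ∀ h → All (Fits r₀) h → All (Fits r₀) (meld r₀ (s ∷ h₁) h)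
  go []      []                = s-fits ∷ h₁-fits
  go (t ∷ h) (t-fits ∷ h-fits) with <-cmp (rank s) (rank t)
  ... | tri< _ _ _   = s-fits ∷ meld-fits h₁ (t ∷ h) h₁-fits (t-fits ∷ h-fits)
  ... | tri> _ _ _   = t-fits ∷ go h h-fits
  ... | tri≈ _ s≡t _ = carry-fits (link r₀ s t) (meld r₀ h₁ h)
                         (link-fits s t s≡t s-fits t-fits) (meld-fits h₁ h h₁-fits h-fits)

dropEmpty-fits : ∀ {r₀} s → Fits r₀ s → All (Fits r₀) (dropEmpty s)
dropEmpty-fits (mkSeq r [])       _      = []
dropEmpty-fits (mkSeq r (x ∷ xs)) s-fits = s-fits ∷ []

extractMin-fits : ∀ {r₀ h h'} → ExtractMin h h' → All (Fits r₀) h → All (Fits r₀) h'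
extractMin-fits (fromCorruption pre _ _ _ _ _ _ _ _ _) h-fits with ++⁻ pre h-fits
... | pre-fits , s-fits ∷ post-fits = ++⁺ pre-fits (s-fits ∷ post-fits)
extractMin-fits (removeHead pre _ r _ xs _) h-fits with ++⁻ pre h-fits
... | pre-fits , s-fits ∷ post-fits =
  ++⁺ pre-fits (++⁺ (dropEmpty-fits (mkSeq r xs) (≤-trans (n≤1+n _) s-fits)) post-fits)

reachable⇒fits : ∀ {r₀ h} → Reachable r₀ h → All (Fits r₀) h
reachable⇒fits empty         = []
reachable⇒fits (ins k ρ)     = carry-fits _ _ (s≤s z≤n) (reachable⇒fits ρ)
reachable⇒fits (mld ρ₁ ρ₂)   = meld-fits _ _ (reachable⇒fits ρ₁) (reachable⇒fits ρ₂)
reachable⇒fits (extract ρ e) = extractMin-fits e (reachable⇒fits ρ)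

-- The bound holds for every r₀; ε only determines which r₀ is meant.
lemma2 : (ε : ℚ) → 0ℚ < ε → ε < 1ℚ → (r₀ : ℕ) → IsCeilLgInv ε r₀ →
    (h : Heap) → Reachable r₀ h →
    (s : Seq) → s ∈ h → length (items s) ≤ sizeBound r₀ (rank s)
lemma2 _ _ _ r₀ _ _ ρ s s∈h =
  ≤-trans (m≤m+n _ (slack r₀ (rank s))) (All.lookup (reachable⇒fits ρ) s∈h)
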